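{- Let $D=(V,A)$ be a strong s-quadrangular digraph with at least two vertices. Then $D$ has a cycle factor, i.e. a collection of pairwise vertex-disjoint directed cycles of $D$ such that every vertex of $D$ lies on one of them.
   Context: All digraphs are finite, without loops or multiple arcs. For $x\neq y$, $x$ dominates $y$ if $xy\in A$. $N^+(x)$ is the set of vertices dominated by $x$ (out-neighbors) and $N^-(x)$ the set of vertices dominating $x$ (in-neighbors). A set $S\subseteq V$ is a $q^+$-set ($q^-$-set, respectively) if $|S|\ge 2$ and for every $u\in S$ there is $v\in S$, $v\neq u$, with $N^+(u)\cap N^+(v)\neq\emptyset$ ($N^-(u)\cap N^-(v)\neq\emptyset$, respectively). $D$ is s-quadrangular if for every $q^+$-set $S$, $\left|\bigcup\{N^+(u)\cap N^+(v): u\neq v,\ u,v\in S\}\right|\ge |S|$, and for every $q^-$-set $S$, $\left|\bigcup\{N^-(u)\cap N^-(v): u\neq v,\ u,v\in S\}\right|\ge |S|$. $D$ is strong if for every ordered pair $x,y$ of vertices there is a directed path from $x$ to $y$. -}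

module Defs where

open import Data.Nat using (ℕ; _≤_)
open import Data.Fin using (Fin; _≟_)
open import Data.Fin.Subset using (Subset; _∈_; ∣_∣)
open import Data.Fin.Subset.Properties using (_∈?_)
open import Data.Fin.Properties using (any?)
open import Data.Vec using (tabulate)
open import Data.List using (List; []; _∷_; concatMap)
open import Data.List.Relation.Unary.All using (All)
open import Data.List.Relation.Unary.Unique.Propositional using (Unique)
import Data.List.Membership.Propositional as LM
open import Data.Product using (Σ; ∃; ∃-syntax; _×_; _,_)
open import Data.Product.Nary.NonDependent using ()
open import Relation.Nullary using (¬_; Dec)
open import Relation.Nullary.Decidable using (⌊_⌋; _×-dec_; ¬?)
open import Relation.Binary using (Decidable)
open import Relation.Binary.PropositionalEquality using (_≡_; _≢_)
open import Relation.Binary.Construct.Closure.ReflexiveTransitive using (Star)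

-- A finite digraph on vertex set Fin n: an irreflexive (loopless)
-- decidable arc relation; arc x y means x dominates y (xy ∈ A).
record Digraph (n : ℕ) : Set₁ where
  field
    arc      : Fin n → Fin n → Set
    arc?     : Decidable arc
    loopless : ∀ x → ¬ arc x x
open Digraph public

module _ {n : ℕ} (D : Digraph n) where

  CommonOut : Fin n → Fin n → Fin n → Set
  CommonOut u v w = arc D u w × arc D v w

  CommonIn : Fin n → Fin n → Fin n → Set
  CommonIn u v w = arc D w u × arc D w v

  IsQPlus : Subset n → Set
  IsQPlus S = 2 ≤ ∣ S ∣ ×
    (∀ u → u ∈ S → ∃[ v ] (v ∈ S × v ≢ u × ∃[ w ] CommonOut u v w))

  IsQMinus : Subset n → Set
  IsQMinus S = 2 ≤ ∣ S ∣ ×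
    (∀ u → u ∈ S → ∃[ v ] (v ∈ S × v ≢ u × ∃[ w ] CommonIn u v w))

  UnionCommonOut : Subset n → Subset n
  UnionCommonOut S = tabulate λ w → ⌊ any? (λ u → any? (λ v →
      (u ∈? S) ×-dec ((v ∈? S) ×-dec (¬? (u ≟ v) ×-dec
        (arc? D u w ×-dec arc? D v w)))) ) ⌋

  UnionCommonIn : Subset n → Subset n
  UnionCommonIn S = tabulate λ w → ⌊ any? (λ u → any? (λ v →
      (u ∈? S) ×-dec ((v ∈? S) ×-dec (¬? (u ≟ v) ×-dec
        (arc? D w u ×-dec arc? D w v)))) ) ⌋

  SQuadrangular : Set
  SQuadrangular =
    (∀ S → IsQPlus S → ∣ S ∣ ≤ ∣ UnionCommonOut S ∣) ×
    (∀ S → IsQMinus S → ∣ S ∣ ≤ ∣ UnionCommonIn S ∣)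

  Strong : Set
  Strong = ∀ x y → Star (arc D) x y

  ClosedTrail : Fin n → Fin n → List (Fin n) → Set
  ClosedTrail s c []       = arc D c s
  ClosedTrail s c (y ∷ r)  = arc D c y × ClosedTrail s y r

  -- a directed cycle x → x₁ → … → x_k → x with distinct vertices
  -- (k ≥ 1, which is automatic for loopless digraphs)
  IsCycle : Fin n → List (Fin n) → Set
  IsCycle x xs = Unique (x ∷ xs) × ClosedTrail x x xs

  cycleVertices : List (Σ (Fin n) (λ _ → List (Fin n))) → List (Fin n)
  cycleVertices = concatMap (λ { (x , xs) → x ∷ xs })

  -- a cycle factor: a list of directed cycles, pairwise vertex-disjoint
  -- (all listed vertices distinct), covering every vertex
  CycleFactor : Set
  CycleFactor = Σ (List (Σ (Fin n) (λ _ → List (Fin n)))) λ Cs →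
    All (λ { (x , xs) → IsCycle x xs }) Cs ×
    Unique (cycleVertices Cs) ×
    (∀ v → v LM.∈ cycleVertices Cs)

{-# OPTIONS --safe #-}
-- An injective map s with an arc u → s u at every vertex u permutes the vertices, and its
-- orbits are directed cycles covering D. Such an s is a transversal of the family of
-- out-neighbourhoods, so by Hall's theorem it suffices that |N⁺(S)| ≥ |S| for every S.
-- Split S into the set S⁺ of vertices sharing an out-neighbour with another vertex of S
-- and the rest S⁻. S⁺ is empty or a q⁺-set, so it has at least |S⁺| shared out-neighbours.
-- The vertices of S⁻ have nonempty (D is strong) and pairwise disjoint out-neighbourhoods,
-- which also avoid the shared out-neighbours of S⁺; hence |N⁺(S)| ≥ |S⁻| + |S⁺|.
--
-- Hall's theorem is proved following Rado: in a family satisfying Hall's condition, one of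
-- any two elements of a member can be deleted without violating the condition, and
-- deleting until every member has at most one element leaves a transversal.
module Submission where

open import Defs
open import Data.Nat using (ℕ; zero; suc; _+_; _∸_; _≤_; _<_; z≤n; s≤s; _<?_; _≤?_)
open import Data.Nat.Properties
  using ( +-suc; +-identityʳ; +-mono-≤; ≤-trans; ≤-pred; n>0⇒n≢0; 1+n≰n; ≮⇒≥; ≰⇒>
        ; m≤m+n; m≤n+m; n<1+n; m≤n⇒m≤1+n; m+[n∸m]≡n; module ≤-Reasoning)
open import Data.Nat.Induction using (<-wellFounded)
open import Data.Fin using (Fin; zero; suc; toℕ; _≟_; punchIn)
open import Data.Fin.Properties using (any?; 0≢1+n; suc-injective; pigeonhole; punchInᵢ≢i)
open import Data.Product using (Σ; ∃; ∃-syntax; _×_; _,_; proj₁; proj₂; uncurry)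
open import Data.Sum using (_⊎_; inj₁; inj₂)
open import Data.Empty using (⊥-elim)
open import Data.List using (List; []; _∷_; _++_; applyUpTo; allFin)
open import Data.List.Relation.Unary.All using (All; []; _∷_)
import Data.List.Relation.Unary.All as All
open import Data.List.Membership.Propositional.Properties using (∈-allFin)
open import Function using (_∘_; id)
open import Function.Definitions using (Injective)
open import Induction.WellFounded using (Acc; acc)
open import Level using (Level)
open import Relation.Nullary using (¬_; yes; no; contradiction)
open import Relation.Unary using (Pred; Decidable)
open import Relation.Binary using (Rel)
open import Relation.Binary.Construct.Closure.ReflexiveTransitive using (Star; ε; _◅_)
open import Relation.Binary.PropositionalEquality

private variable
  ℓ ℓ′ : Level
  n : ℕ

module Hall where

  open import Data.Fin.Subset
  open import Data.Fin.Subset.Properties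
  open import Data.Vec using ([]; _∷_; here; there; tabulate)
  open import Data.Vec.Properties using (lookup∘tabulate; []=⇒lookup; lookup⇒[]=)
  open import Data.Vec.Functional using (updateAt)
  open import Data.Vec.Functional.Properties using (updateAt-updates; updateAt-minimal)
  open import Function.Bundles using (Equivalence)
  open import Relation.Nullary.Decidable using (⌊_⌋; _×-dec_; ¬?; dec-true; isYes≗does)

  module _ {P : Pred (Fin n) ℓ} where

    subset : Decidable P → Subset n
    subset P? = tabulate (λ x → ⌊ P? x ⌋)

    ∈-subset⁺ : {P? : Decidable P} {x : Fin n} → P x → x ∈ subset P?
    ∈-subset⁺ {P?} {x} px =
      lookup⇒[]= x _ (trans (lookup∘tabulate _ x) (trans (isYes≗does (P? x)) (dec-true (P? x) px)))

    ∈-subset⁻ : {P? : Decidable P} {x : Fin n} → x ∈ subset P? → P x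
    ∈-subset⁻ {P?} {x} x∈ with P? x | trans (sym (lookup∘tabulate _ x)) ([]=⇒lookup x∈)
    ... | yes px | _ = px

  ∣p∪q∣+∣p∩q∣≡∣p∣+∣q∣ : (p q : Subset n) → ∣ p ∪ q ∣ + ∣ p ∩ q ∣ ≡ ∣ p ∣ + ∣ q ∣
  ∣p∪q∣+∣p∩q∣≡∣p∣+∣q∣ []            []            = refl
  ∣p∪q∣+∣p∩q∣≡∣p∣+∣q∣ (inside ∷ p)  (inside ∷ q)  =
    cong suc (trans (+-suc _ _) (trans (cong suc (∣p∪q∣+∣p∩q∣≡∣p∣+∣q∣ p q)) (sym (+-suc _ _))))
  ∣p∪q∣+∣p∩q∣≡∣p∣+∣q∣ (inside ∷ p)  (outside ∷ q) = cong suc (∣p∪q∣+∣p∩q∣≡∣p∣+∣q∣ p q)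
  ∣p∪q∣+∣p∩q∣≡∣p∣+∣q∣ (outside ∷ p) (inside ∷ q)  =
    trans (cong suc (∣p∪q∣+∣p∩q∣≡∣p∣+∣q∣ p q)) (sym (+-suc _ _))
  ∣p∪q∣+∣p∩q∣≡∣p∣+∣q∣ (outside ∷ p) (outside ∷ q) = ∣p∪q∣+∣p∩q∣≡∣p∣+∣q∣ p q

  ∣p∪q∣≤∣p∣+∣q∣ : (p q : Subset n) → ∣ p ∪ q ∣ ≤ ∣ p ∣ + ∣ q ∣
  ∣p∪q∣≤∣p∣+∣q∣ p q = subst (∣ p ∪ q ∣ ≤_) (∣p∪q∣+∣p∩q∣≡∣p∣+∣q∣ p q) (m≤m+n _ _)

  Empty⇒∣p∣≡0 : {p : Subset n} → Empty p → ∣ p ∣ ≡ 0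
  Empty⇒∣p∣≡0 {n} p-empty = trans (cong ∣_∣ (Empty-unique p-empty)) (∣⊥∣≡0 n)

  Empty[p∩q]⇒∣p∪q∣≡∣p∣+∣q∣ : (p q : Subset n) → Empty (p ∩ q) → ∣ p ∪ q ∣ ≡ ∣ p ∣ + ∣ q ∣
  Empty[p∩q]⇒∣p∪q∣≡∣p∣+∣q∣ p q p∩q-empty = begin
    ∣ p ∪ q ∣             ≡⟨ +-identityʳ _ ⟨
    ∣ p ∪ q ∣ + 0         ≡⟨ cong (∣ p ∪ q ∣ +_) (Empty⇒∣p∣≡0 p∩q-empty) ⟨
    ∣ p ∪ q ∣ + ∣ p ∩ q ∣ ≡⟨ ∣p∪q∣+∣p∩q∣≡∣p∣+∣q∣ p q ⟩
    ∣ p ∣ + ∣ q ∣         ∎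
    where open ≡-Reasoning

  p⊆[p─q]∪q : (p q : Subset n) → p ⊆ (p ─ q) ∪ q
  p⊆[p─q]∪q p q {x} x∈p with x ∈? q
  ... | yes x∈q = q⊆p∪q (p ─ q) q x∈q
  ... | no  x∉q = p⊆p∪q q (x∈p∧x∉q⇒x∈p─q x∈p x∉q)

  x∈p─q⇒x∉q : (p q : Subset n) {x : Fin n} → x ∈ p ─ q → x ∉ q
  x∈p─q⇒x∉q (_ ∷ p) (inside ∷ q) {zero}  ()         here
  x∈p─q⇒x∉q (_ ∷ p) (_ ∷ q)      {suc x} (there x∈) (there x∈q) = x∈p─q⇒x∉q p q x∈ x∈q

  x∈p-y⇒x≢y : ∀ {p : Subset n} {x y} → x ∈ p - y → x ≢ y
  x∈p-y⇒x≢y {p = p} {y = y} = x∉⁅y⁆⇒x≢y ∘ x∈p─q⇒x∉q p ⁅ y ⁆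

  ∣p∣≡1+∣p-x∣ : (p : Subset n) {x : Fin n} → x ∈ p → ∣ p ∣ ≡ suc ∣ p - x ∣
  ∣p∣≡1+∣p-x∣ (inside ∷ p)  {zero}  here       = cong (suc ∘ ∣_∣) (sym (p─⊥≡p p))
  ∣p∣≡1+∣p-x∣ (inside ∷ p)  {suc x} (there x∈) = cong suc (∣p∣≡1+∣p-x∣ p x∈)
  ∣p∣≡1+∣p-x∣ (outside ∷ p) {suc x} (there x∈) = ∣p∣≡1+∣p-x∣ p x∈

  ∣p∣>0⇒Nonempty : (p : Subset n) → 0 < ∣ p ∣ → Nonempty p
  ∣p∣>0⇒Nonempty p ∣p∣>0 with nonempty? p
  ... | yes p-nonempty = p-nonempty
  ... | no  p-empty    = contradiction (Empty⇒∣p∣≡0 p-empty) (n>0⇒n≢0 ∣p∣>0)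

  x∈p⇒∣p∣>0 : ∀ {p : Subset n} {x} → x ∈ p → 0 < ∣ p ∣
  x∈p⇒∣p∣>0 {p = p} x∈p rewrite ∣p∣≡1+∣p-x∣ p x∈p = s≤s z≤n

  x≢y∈p⇒∣p∣≥2 : ∀ {p : Subset n} {x y} → x ∈ p → y ∈ p → x ≢ y → 2 ≤ ∣ p ∣
  x≢y∈p⇒∣p∣≥2 {p = p} x∈p y∈p x≢y rewrite ∣p∣≡1+∣p-x∣ p x∈p =
    s≤s (x∈p⇒∣p∣>0 (x∈p∧x≢y⇒x∈p-y y∈p (x≢y ∘ sym)))

  ∣p∣≥2⇒x≢y∈p : (p : Subset n) → 2 ≤ ∣ p ∣ → ∃[ x ] ∃[ y ] (x ∈ p × y ∈ p × x ≢ y)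
  ∣p∣≥2⇒x≢y∈p p ∣p∣≥2 with ∣p∣>0⇒Nonempty p (≤-trans (s≤s z≤n) ∣p∣≥2)
  ... | x , x∈p with ∣p∣>0⇒Nonempty (p - x) (≤-pred (subst (2 ≤_) (∣p∣≡1+∣p-x∣ p x∈p) ∣p∣≥2))
  ...   | y , y∈p-x = x , y , x∈p , p─q⊆p p ⁅ x ⁆ y∈p-x , x∈p-y⇒x≢y y∈p-x ∘ sym

  ∣p∣≤1⇒x≡y : ∀ {p : Subset n} {x y} → ∣ p ∣ ≤ 1 → x ∈ p → y ∈ p → x ≡ y
  ∣p∣≤1⇒x≡y {x = x} {y} ∣p∣≤1 x∈p y∈p with x ≟ y
  ... | yes x≡y = x≡y
  ... | no  x≢y = contradiction (≤-trans (x≢y∈p⇒∣p∣≥2 x∈p y∈p x≢y) ∣p∣≤1) 1+n≰n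

  injection⇒∣p∣≤∣q∣ : ∀ {m} (p : Subset n) (q : Subset m) (f : Fin n → Fin m) →
    (∀ {x} → x ∈ p → f x ∈ q) → (∀ {x y} → x ∈ p → y ∈ p → f x ≡ f y → x ≡ y) →
    ∣ p ∣ ≤ ∣ q ∣
  injection⇒∣p∣≤∣q∣ []            q f f∈q f-injective = z≤n
  injection⇒∣p∣≤∣q∣ (outside ∷ p) q f f∈q f-injective =
    injection⇒∣p∣≤∣q∣ p q (f ∘ suc) (f∈q ∘ there)
      λ x∈ y∈ fx≡fy → suc-injective (f-injective (there x∈) (there y∈) fx≡fy)
  injection⇒∣p∣≤∣q∣ (inside ∷ p)  q f f∈q f-injective rewrite ∣p∣≡1+∣p-x∣ q (f∈q here) =
    s≤s (injection⇒∣p∣≤∣q∣ p (q - f zero) (f ∘ suc)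
      (λ x∈ → x∈p∧x≢y⇒x∈p-y (f∈q (there x∈)) (0≢1+n ∘ f-injective here (there x∈) ∘ sym))
      λ x∈ y∈ fx≡fy → suc-injective (f-injective (there x∈) (there y∈) fx≡fy))

  module _ {k m : ℕ} where

    image : (Fin k → Subset m) → Subset k → Subset m
    image F S = subset (λ y → any? (λ i → (i ∈? S) ×-dec (y ∈? F i)))

    ∈-image⁺ : (F : Fin k → Subset m) {S : Subset k} {i : Fin k} {y : Fin m} →
               i ∈ S → y ∈ F i → y ∈ image F S
    ∈-image⁺ F i∈S y∈Fi = ∈-subset⁺ (_ , i∈S , y∈Fi)

    ∈-image⁻ : (F : Fin k → Subset m) {S : Subset k} {y : Fin m} →
               y ∈ image F S → ∃[ i ] (i ∈ S × y ∈ F i)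
    ∈-image⁻ F = ∈-subset⁻

    image-⊆ : ∀ {F : Fin k → Subset m} {S T} → (∀ {i} → i ∈ S → F i ⊆ T) → image F S ⊆ T
    image-⊆ {F} F⊆T y∈ with ∈-image⁻ F y∈
    ... | i , i∈S , y∈Fi = F⊆T i∈S y∈Fi

    image-mono : ∀ {F G : Fin k → Subset m} {S T} → S ⊆ T → (∀ {i} → i ∈ S → F i ⊆ G i) →
                 image F S ⊆ image G T
    image-mono {G = G} S⊆T F⊆G = image-⊆ λ i∈S y∈Fi → ∈-image⁺ G (S⊆T i∈S) (F⊆G i∈S y∈Fi)

    HallCondition : (Fin k → Subset m) → Set
    HallCondition F = ∀ S → ∣ S ∣ ≤ ∣ image F S ∣

    Transversal : (Fin k → Subset m) → Set
    Transversal F = Σ (Fin k → Fin m) λ t → (∀ i → t i ∈ F i) × Injective _≡_ _≡_ t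

    _⊑_ : (F G : Fin k → Subset m) → Set
    F ⊑ G = ∀ i → F i ⊆ G i

    ⊑-refl : ∀ {F} → F ⊑ F
    ⊑-refl i y∈ = y∈

    ⊑-trans : ∀ {F G H} → F ⊑ G → G ⊑ H → F ⊑ H
    ⊑-trans F⊑G G⊑H i y∈ = G⊑H i (F⊑G i y∈)

    hall-or-violator : ∀ F → HallCondition F ⊎ ∃[ S ] ∣ image F S ∣ < ∣ S ∣
    hall-or-violator F with anySubset? (λ S → ∣ image F S ∣ <? ∣ S ∣)
    ... | yes violator   = inj₂ violator
    ... | no no-violator = inj₁ λ S → ≮⇒≥ λ violates → no-violator (S , violates)

    deleteAt : (Fin k → Subset m) → Fin k → Fin m → Fin k → Subset m
    deleteAt F x z = updateAt F x (_- z)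

    ∈-deleteAt⁺ : ∀ {F x z i y} → y ∈ F i → (i ≡ x → y ≢ z) → y ∈ deleteAt F x z i
    ∈-deleteAt⁺ {F} {x} {z} {i} y∈Fi y≢z with i ≟ x
    ... | yes refl = subst (_ ∈_) (sym (updateAt-updates x F)) (x∈p∧x≢y⇒x∈p-y y∈Fi (y≢z refl))
    ... | no  i≢x  = subst (_ ∈_) (sym (updateAt-minimal i x F i≢x)) y∈Fi

    deleteAt-⊑ : ∀ {F x z} → deleteAt F x z ⊑ F
    deleteAt-⊑ {F} {x} {z} i with i ≟ x
    ... | yes refl = p─q⊆p (F x) ⁅ z ⁆ ∘ subst (_ ∈_) (updateAt-updates x F)
    ... | no  i≢x  = subst (_ ∈_) (updateAt-minimal i x F i≢x)

    ∣deleteAt∣<∣F∣ : ∀ {F x z} → z ∈ F x → ∣ deleteAt F x z x ∣ < ∣ F x ∣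
    ∣deleteAt∣<∣F∣ {F} {x} z∈Fx =
      subst (λ p → ∣ p ∣ < ∣ F x ∣) (sym (updateAt-updates x F)) (x∈p⇒∣p-x∣<∣p∣ z∈Fx)

    module _ {F : Fin k → Subset m} (hall : HallCondition F) {x : Fin k} where

      violator-∋ : ∀ {z S} → ∣ image (deleteAt F x z) S ∣ < ∣ S ∣ → x ∈ S
      violator-∋ {z} {S} violates with x ∈? S
      ... | yes x∈S = x∈S
      ... | no  x∉S = ⊥-elim (1+n≰n (≤-trans violates (≤-trans (hall S) (p⊆q⇒∣p∣≤∣q∣ F[S]⊆F′[S]))))
        where
        F[S]⊆F′[S] : image F S ⊆ image (deleteAt F x z) S
        F[S]⊆F′[S] = image-mono id λ i∈S y∈Fi → ∈-deleteAt⁺ y∈Fi λ { refl → contradiction i∈S x∉S }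

      -- The images of A and B under the two shrunk families jointly cover the images of
      -- A ∪ B and A ∩ B - x under F, and x ∈ A ∩ B; so Hall's condition for these two sets
      -- forces |F₁(A)| + |F₂(B)| ≥ |A| + |B| - 1.
      violators-clash : ∀ {y₁ y₂ A B} → y₁ ≢ y₂ →
        ∣ image (deleteAt F x y₁) A ∣ < ∣ A ∣ → ∣ image (deleteAt F x y₂) B ∣ < ∣ B ∣ →
        Data.Empty.⊥
      violators-clash {y₁} {y₂} {A} {B} y₁≢y₂ A-violates B-violates = 1+n≰n (begin
        suc (suc (a + b))                   ≡⟨ cong suc (+-suc a b) ⟨
        suc a + suc b                       ≤⟨ +-mono-≤ A-violates B-violates ⟩
        ∣ A ∣ + ∣ B ∣                         ≡⟨ ∣p∪q∣+∣p∩q∣≡∣p∣+∣q∣ A B ⟨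
        ∣ A ∪ B ∣ + ∣ A ∩ B ∣                 ≡⟨ cong (∣ A ∪ B ∣ +_) (∣p∣≡1+∣p-x∣ (A ∩ B) x∈A∩B) ⟩
        ∣ A ∪ B ∣ + suc ∣ A ∩ B - x ∣         ≤⟨ +-mono-≤ (hall (A ∪ B)) (s≤s (hall (A ∩ B - x))) ⟩
        ∣ image F (A ∪ B) ∣ + suc ∣ image F (A ∩ B - x) ∣
          ≤⟨ +-mono-≤ (p⊆q⇒∣p∣≤∣q∣ (image-⊆ ∪-cover)) (s≤s (p⊆q⇒∣p∣≤∣q∣ (image-⊆ ∩-cover))) ⟩
        ∣ F₁A ∪ F₂B ∣ + suc ∣ F₁A ∩ F₂B ∣     ≡⟨ +-suc _ _ ⟩
        suc (∣ F₁A ∪ F₂B ∣ + ∣ F₁A ∩ F₂B ∣)   ≡⟨ cong suc (∣p∪q∣+∣p∩q∣≡∣p∣+∣q∣ F₁A F₂B) ⟩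
        suc (a + b)                         ∎)
        where
        open ≤-Reasoning
        F₁A = image (deleteAt F x y₁) A
        F₂B = image (deleteAt F x y₂) B
        a = ∣ F₁A ∣
        b = ∣ F₂B ∣
        x∈A = violator-∋ A-violates
        x∈B = violator-∋ B-violates

        x∈A∩B : x ∈ A ∩ B
        x∈A∩B = x∈p∩q⁺ (x∈A , x∈B)

        ∪-cover : ∀ {i} → i ∈ A ∪ B → F i ⊆ F₁A ∪ F₂B
        ∪-cover {i} i∈A∪B {y} y∈Fi with i ≟ x | y ≟ y₁ | x∈p∪q⁻ A B i∈A∪B
        ... | yes refl | no y≢y₁  | _        =
          p⊆p∪q F₂B (∈-image⁺ _ x∈A (∈-deleteAt⁺ y∈Fi λ _ → y≢y₁))
        ... | yes refl | yes refl | _        =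
          q⊆p∪q F₁A F₂B (∈-image⁺ _ x∈B (∈-deleteAt⁺ y∈Fi λ _ → y₁≢y₂))
        ... | no  i≢x  | _        | inj₁ i∈A =
          p⊆p∪q F₂B (∈-image⁺ _ i∈A (∈-deleteAt⁺ y∈Fi (⊥-elim ∘ i≢x)))
        ... | no  i≢x  | _        | inj₂ i∈B =
          q⊆p∪q F₁A F₂B (∈-image⁺ _ i∈B (∈-deleteAt⁺ y∈Fi (⊥-elim ∘ i≢x)))

        ∩-cover : ∀ {i} → i ∈ A ∩ B - x → F i ⊆ F₁A ∩ F₂B
        ∩-cover {i} i∈ {y} y∈Fi with x∈p∩q⁻ A B (p─q⊆p (A ∩ B) ⁅ x ⁆ i∈)
        ... | i∈A , i∈B = x∈p∩q⁺ (∈-image⁺ _ i∈A y∈F′i , ∈-image⁺ _ i∈B y∈F′i)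
          where
          y∈F′i : ∀ {z} → y ∈ deleteAt F x z i
          y∈F′i = ∈-deleteAt⁺ y∈Fi (⊥-elim ∘ x∈p-y⇒x≢y i∈)

      removable : 2 ≤ ∣ F x ∣ → ∃[ y ] (y ∈ F x × HallCondition (deleteAt F x y))
      removable ∣Fx∣≥2 with ∣p∣≥2⇒x≢y∈p (F x) ∣Fx∣≥2
      ... | y₁ , y₂ , y₁∈Fx , y₂∈Fx , y₁≢y₂ with hall-or-violator (deleteAt F x y₁)
      ...   | inj₁ hall₁             = y₁ , y₁∈Fx , hall₁
      ...   | inj₂ (A , A-violates) = y₂ , y₂∈Fx , λ B → ≮⇒≥ (violators-clash y₁≢y₂ A-violates)

    shrinkAt : ∀ x F → Acc _<_ ∣ F x ∣ → HallCondition F →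
               ∃[ G ] (G ⊑ F × HallCondition G × ∣ G x ∣ ≤ 1)
    shrinkAt x F (acc rec) hall with ∣ F x ∣ ≤? 1
    ... | yes ∣Fx∣≤1 = F , ⊑-refl , hall , ∣Fx∣≤1
    ... | no  ∣Fx∣≰1 with removable hall (≰⇒> ∣Fx∣≰1)
    ...   | y , y∈Fx , hall′ with shrinkAt x (deleteAt F x y) (rec (∣deleteAt∣<∣F∣ y∈Fx)) hall′
    ...     | G , G⊑F′ , hallG , ∣Gx∣≤1 = G , ⊑-trans G⊑F′ deleteAt-⊑ , hallG , ∣Gx∣≤1

    shrinkAll : ∀ xs F → HallCondition F →
                ∃[ G ] (G ⊑ F × HallCondition G × All (λ i → ∣ G i ∣ ≤ 1) xs)
    shrinkAll []       F hall = F , ⊑-refl , hall , []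
    shrinkAll (x ∷ xs) F hall with shrinkAll xs F hall
    ... | G , G⊑F , hallG , G-small with shrinkAt x G (<-wellFounded _) hallG
    ...   | H , H⊑G , hallH , ∣Hx∣≤1 =
      H , ⊑-trans H⊑G G⊑F , hallH , ∣Hx∣≤1 ∷ All.map (≤-trans (p⊆q⇒∣p∣≤∣q∣ (H⊑G _))) G-small

    small-transversal : ∀ {F} → HallCondition F → (∀ i → ∣ F i ∣ ≤ 1) → Transversal F
    small-transversal {F} hall small = t , t∈F , t-injective
      where
      pick : ∀ i → Nonempty (F i)
      pick i with ∣p∣>0⇒Nonempty (image F ⁅ i ⁆) (subst (_≤ ∣ image F ⁅ i ⁆ ∣) (∣⁅x⁆∣≡1 i) (hall ⁅ i ⁆))
      ... | y , y∈ = y , image-⊆ (λ j∈⁅i⁆ → subst (λ j → _ ∈ F j) (x∈⁅y⁆⇒x≡y i j∈⁅i⁆)) y∈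

      t : Fin k → Fin m
      t = proj₁ ∘ pick

      t∈F : ∀ i → t i ∈ F i
      t∈F = proj₂ ∘ pick

      only-t : ∀ {i y} → y ∈ F i → y ≡ t i
      only-t {i} y∈Fi = ∣p∣≤1⇒x≡y (small i) y∈Fi (t∈F i)

      t-injective : Injective _≡_ _≡_ t
      t-injective {i} {j} tᵢ≡tⱼ with i ≟ j
      ... | yes i≡j = i≡j
      ... | no  i≢j = contradiction (≤-trans ∣S∣≥2 (≤-trans (hall S) ∣F[S]∣≤1)) 1+n≰n
        where
        S = ⁅ i ⁆ ∪ ⁅ j ⁆

        ∣S∣≥2 : 2 ≤ ∣ S ∣
        ∣S∣≥2 = x≢y∈p⇒∣p∣≥2 (p⊆p∪q ⁅ j ⁆ (x∈⁅x⁆ i)) (q⊆p∪q ⁅ i ⁆ ⁅ j ⁆ (x∈⁅x⁆ j)) i≢j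

        y≡tᵢ : ∀ {l y} → l ∈ S → y ∈ F l → y ≡ t i
        y≡tᵢ {l} l∈S y∈Fl with x∈p∪q⁻ ⁅ i ⁆ ⁅ j ⁆ l∈S
        ... | inj₁ l∈⁅i⁆ = trans (only-t y∈Fl) (cong t (x∈⁅y⁆⇒x≡y i l∈⁅i⁆))
        ... | inj₂ l∈⁅j⁆ = trans (only-t y∈Fl) (trans (cong t (x∈⁅y⁆⇒x≡y j l∈⁅j⁆)) (sym tᵢ≡tⱼ))

        ∣F[S]∣≤1 : ∣ image F S ∣ ≤ 1
        ∣F[S]∣≤1 = subst (∣ image F S ∣ ≤_) (∣⁅x⁆∣≡1 (t i))
          (p⊆q⇒∣p∣≤∣q∣ (image-⊆ λ l∈S y∈Fl → Equivalence.from x∈⁅y⁆⇔x≡y (y≡tᵢ l∈S y∈Fl)))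

    hall : ∀ F → HallCondition F → Transversal F
    hall F hallF with shrinkAll (allFin k) F hallF
    ... | G , G⊑F , hallG , G-small with small-transversal hallG (λ i → All.lookup G-small (∈-allFin i))
    ...   | t , t∈G , t-injective = t , (λ i → G⊑F i (t∈G i)) , t-injective

  module _ (D : Digraph n) where

    outNeighbours : Fin n → Subset n
    outNeighbours u = subset (arc? D u)

    sharing : Subset n → Subset n
    sharing S = subset λ u → (u ∈? S) ×-dec
      any? (λ v → (v ∈? S) ×-dec (¬? (v ≟ u) ×-dec any? (λ w → arc? D u w ×-dec arc? D v w)))

    lonely : Subset n → Subset n
    lonely S = S ─ sharing S

    ∈-sharing⁺ : ∀ {S u v w} → u ∈ S → v ∈ S → v ≢ u → arc D u w → arc D v w → u ∈ sharing S
    ∈-sharing⁺ u∈S v∈S v≢u uw vw = ∈-subset⁺ (u∈S , _ , v∈S , v≢u , _ , uw , vw)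

    sharing⊆ : ∀ {S} → sharing S ⊆ S
    sharing⊆ = proj₁ ∘ ∈-subset⁻

    sharing-partner : ∀ {S u} → u ∈ sharing S →
                      ∃[ v ] (v ∈ sharing S × v ≢ u × ∃[ w ] CommonOut D u v w)
    sharing-partner u∈ with ∈-subset⁻ u∈
    ... | u∈S , v , v∈S , v≢u , w , uw , vw =
      v , ∈-sharing⁺ v∈S u∈S (v≢u ∘ sym) vw uw , v≢u , w , uw , vw

    sharing-bound : (∀ S → IsQPlus D S → ∣ S ∣ ≤ ∣ UnionCommonOut D S ∣) →
                    ∀ S → ∣ sharing S ∣ ≤ ∣ UnionCommonOut D (sharing S) ∣
    sharing-bound q⁺-bound S with nonempty? (sharing S)
    ... | no  empty    = subst (_≤ ∣ UnionCommonOut D (sharing S) ∣) (sym (Empty⇒∣p∣≡0 empty)) z≤n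
    ... | yes (u , u∈) = q⁺-bound (sharing S) (∣S⁺∣≥2 , λ _ → sharing-partner)
      where
      ∣S⁺∣≥2 : 2 ≤ ∣ sharing S ∣
      ∣S⁺∣≥2 = let v , v∈ , v≢u , _ = sharing-partner u∈ in x≢y∈p⇒∣p∣≥2 u∈ v∈ (v≢u ∘ sym)

    lonely-bound : (∀ u → ∃ (arc D u)) → ∀ S → ∣ lonely S ∣ ≤ ∣ image outNeighbours (lonely S) ∣
    lonely-bound out-neighbour S =
      injection⇒∣p∣≤∣q∣ (lonely S) _ choice
        (λ u∈ → ∈-image⁺ outNeighbours u∈ (∈-subset⁺ (proj₂ (out-neighbour _)))) choice-injective
      where
      choice : Fin n → Fin n
      choice = proj₁ ∘ out-neighbour

      choice-injective : ∀ {u v} → u ∈ lonely S → v ∈ lonely S → choice u ≡ choice v → u ≡ v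
      choice-injective {u} {v} u∈ v∈ same-choice with u ≟ v
      ... | yes u≡v = u≡v
      ... | no  u≢v = contradiction
        (∈-sharing⁺ (p─q⊆p S _ u∈) (p─q⊆p S _ v∈) (u≢v ∘ sym) (proj₂ (out-neighbour u))
                    (subst (arc D v) (sym same-choice) (proj₂ (out-neighbour v))))
        (x∈p─q⇒x∉q S (sharing S) u∈)

    lonely-disjoint : ∀ S → Empty (image outNeighbours (lonely S) ∩ UnionCommonOut D (sharing S))
    lonely-disjoint S (w , w∈) with x∈p∩q⁻ _ _ w∈
    ... | w∈N , w∈U with ∈-image⁻ outNeighbours w∈N | ∈-subset⁻ w∈U
    ...   | u , u∈ , uw | a , _ , a∈ , _ , _ , aw , _ =
      u∉ (∈-sharing⁺ (p─q⊆p S _ u∈) (sharing⊆ a∈) (λ { refl → u∉ a∈ }) (∈-subset⁻ uw) aw)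
      where
      u∉ : u ∉ sharing S
      u∉ = x∈p─q⇒x∉q S (sharing S) u∈

    UnionCommonOut⊆image : ∀ S → UnionCommonOut D S ⊆ image outNeighbours S
    UnionCommonOut⊆image S w∈ with ∈-subset⁻ w∈
    ... | u , _ , u∈S , _ , _ , uw , _ = ∈-image⁺ outNeighbours u∈S (∈-subset⁺ uw)

    outNeighbours-hall : (∀ u → ∃ (arc D u)) →
                         (∀ S → IsQPlus D S → ∣ S ∣ ≤ ∣ UnionCommonOut D S ∣) →
                         HallCondition outNeighbours
    outNeighbours-hall out-neighbour q⁺-bound S = begin
      ∣ S ∣                          ≤⟨ p⊆q⇒∣p∣≤∣q∣ (p⊆[p─q]∪q S (sharing S)) ⟩
      ∣ lonely S ∪ sharing S ∣       ≤⟨ ∣p∪q∣≤∣p∣+∣q∣ (lonely S) (sharing S) ⟩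
      ∣ lonely S ∣ + ∣ sharing S ∣
        ≤⟨ +-mono-≤ (lonely-bound out-neighbour S) (sharing-bound q⁺-bound S) ⟩
      ∣ N[S⁻] ∣ + ∣ U[S⁺] ∣           ≡⟨ Empty[p∩q]⇒∣p∪q∣≡∣p∣+∣q∣ N[S⁻] U[S⁺] (lonely-disjoint S) ⟨
      ∣ N[S⁻] ∪ U[S⁺] ∣              ≤⟨ p⊆q⇒∣p∣≤∣q∣ ∪⊆N[S] ⟩
      ∣ image outNeighbours S ∣      ∎
      where
      open ≤-Reasoning
      N[S⁻] = image outNeighbours (lonely S)
      U[S⁺] = UnionCommonOut D (sharing S)

      ∪⊆N[S] : N[S⁻] ∪ U[S⁺] ⊆ image outNeighbours S
      ∪⊆N[S] w∈ with x∈p∪q⁻ N[S⁻] U[S⁺] w∈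
      ... | inj₁ w∈N = image-mono (p─q⊆p S _) (λ _ → id) w∈N
      ... | inj₂ w∈U = image-mono sharing⊆ (λ _ → id) (UnionCommonOut⊆image (sharing S) w∈U)

module Cycles where

  open import Data.List.Relation.Unary.Any using (here)
  open import Data.List.Relation.Unary.Unique.Propositional using (Unique; [])
  open import Data.List.Relation.Unary.Unique.Propositional.Properties using (applyUpTo⁺₁; ++⁺)
  open import Data.List.Relation.Binary.Disjoint.Propositional using (Disjoint)
  open import Data.List.Relation.Binary.Subset.Propositional using (_⊆_)
  open import Data.List.Membership.Propositional using (_∈_)
  open import Data.List.Membership.Propositional.Properties
    using (∈-applyUpTo⁺; ∈-applyUpTo⁻; ∈-++⁻; ∈-++⁺ˡ; ∈-++⁺ʳ)
  import Data.List.Membership.DecPropositional as DecMembership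
  import Function.Endo.Propositional as Endo

  minimal-witness : ∀ {P : Pred ℕ ℓ} → Decidable P → ∀ d → P d →
                    ∃[ m ] (P m × (∀ {j} → j < m → ¬ P j))
  minimal-witness P? zero    p₀ = zero , p₀ , λ ()
  minimal-witness P? (suc d) pₛ with P? zero
  ... | yes p₀ = zero , p₀ , λ ()
  ... | no ¬p₀ with minimal-witness (P? ∘ suc) d pₛ
  ...   | m , pₘ , below = suc m , pₘ , λ { {zero} _ → ¬p₀ ; {suc j} (s≤s j<m) → below j<m }

  module _ (D : Digraph n) where

    closedTrail-applyUpTo : ∀ (h : ℕ → Fin n) m {s} → (∀ i → arc D (h i) (h (suc i))) →
                            h (suc m) ≡ s → ClosedTrail D s (h 0) (applyUpTo (h ∘ suc) m)
    closedTrail-applyUpTo h zero    step refl   = step 0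
    closedTrail-applyUpTo h (suc m) step hₘ₊₂≡s =
      step 0 , closedTrail-applyUpTo (h ∘ suc) m (step ∘ suc) hₘ₊₂≡s

    module _ {g : Fin n → Fin n} (g-arc : ∀ x → arc D x (g x)) (g-injective : Injective _≡_ _≡_ g)
      where

      open Endo (Fin n) using (_^_; ^-homo)
      open DecMembership (_≟_ {n}) using (_∈?_)

      ^-injective : ∀ k → Injective _≡_ _≡_ (g ^ k)
      ^-injective zero    gᵏx≡gᵏy = gᵏx≡gᵏy
      ^-injective (suc k) gᵏx≡gᵏy = ^-injective k (g-injective gᵏx≡gᵏy)

      ^-cancelˡ : ∀ i d {x} → (g ^ i) x ≡ (g ^ (i + d)) x → (g ^ d) x ≡ x
      ^-cancelˡ i d {x} e = ^-injective i (sym (trans e (cong-app (^-homo g i d) x)))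

      eventually-returns : ∀ x → ∃[ d ] (g ^ suc d) x ≡ x
      eventually-returns x with pigeonhole (n<1+n n) (λ i → (g ^ toℕ i) x)
      ... | i , j , i<j , gⁱx≡gʲx = d , ^-cancelˡ (toℕ i) (suc d)
              (trans gⁱx≡gʲx (cong (λ k → (g ^ k) x) (sym (trans (+-suc (toℕ i) d) (m+[n∸m]≡n i<j)))))
        where d = toℕ j ∸ suc (toℕ i)

      first-return : ∀ x → ∃[ m ] ((g ^ suc m) x ≡ x × (∀ {j} → j < m → (g ^ suc j) x ≢ x))
      first-return x = uncurry (minimal-witness (λ j → (g ^ suc j) x ≟ x)) (eventually-returns x)

      cycleAt : Fin n → Σ (Fin n) (λ _ → List (Fin n))
      cycleAt x = x , applyUpTo (λ i → (g ^ suc i) x) (proj₁ (first-return x))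

      orbit : Fin n → List (Fin n)
      orbit x = x ∷ proj₂ (cycleAt x)

      orbit-isCycle : ∀ x m → (g ^ suc m) x ≡ x → (∀ {j} → j < m → (g ^ suc j) x ≢ x) →
                      IsCycle D x (applyUpTo (λ i → (g ^ suc i) x) m)
      orbit-isCycle x m gᵐ⁺¹x≡x minimal =
        applyUpTo⁺₁ (λ i → (g ^ i) x) (suc m) distinct ,
        closedTrail-applyUpTo (λ i → (g ^ i) x) m (λ i → g-arc ((g ^ i) x)) gᵐ⁺¹x≡x
        where
        distinct : ∀ {i j} → i < j → j < suc m → (g ^ i) x ≢ (g ^ j) x
        distinct {i} {j} i<j (s≤s j≤m) gⁱx≡gʲx with j ∸ suc i | m+[n∸m]≡n i<j
        ... | d | refl = minimal (≤-trans (s≤s (m≤n+m d i)) j≤m)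
                           (^-cancelˡ i (suc d) (trans gⁱx≡gʲx (cong (λ k → (g ^ k) x) (sym (+-suc i d)))))

      cycleAt-isCycle : ∀ x → IsCycle D x (proj₂ (cycleAt x))
      cycleAt-isCycle x =
        let m , gᵐ⁺¹x≡x , minimal = first-return x in orbit-isCycle x m gᵐ⁺¹x≡x minimal

      ∈-orbit⁻ : ∀ {x v} → v ∈ orbit x → ∃[ i ] v ≡ (g ^ i) x
      ∈-orbit⁻ {x} v∈ = let i , _ , v≡gⁱx = ∈-applyUpTo⁻ (λ i → (g ^ i) x) v∈ in i , v≡gⁱx

      preimage∈applyUpTo : ∀ x m → (g ^ suc m) x ≡ x → ∀ {y} →
        g y ∈ applyUpTo (λ i → (g ^ i) x) (suc m) → y ∈ applyUpTo (λ i → (g ^ i) x) (suc m)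
      preimage∈applyUpTo x m gᵐ⁺¹x≡x gy∈ with ∈-applyUpTo⁻ (λ i → (g ^ i) x) gy∈
      ... | zero  , _         , gy≡x     = subst (_∈ _) (sym (g-injective (trans gy≡x (sym gᵐ⁺¹x≡x))))
                                             (∈-applyUpTo⁺ (λ i → (g ^ i) x) (n<1+n m))
      ... | suc i , s≤s i<m+1 , gy≡gⁱ⁺¹x = subst (_∈ _) (sym (g-injective gy≡gⁱ⁺¹x))
                                             (∈-applyUpTo⁺ (λ i → (g ^ i) x) (m≤n⇒m≤1+n i<m+1))

      preimage∈orbit : ∀ {x y} → g y ∈ orbit x → y ∈ orbit x
      preimage∈orbit {x} =
        let m , gᵐ⁺¹x≡x , _ = first-return x in preimage∈applyUpTo x m gᵐ⁺¹x≡x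

      -- Closure under preimages of g makes the orbit of a vertex not yet covered disjoint
      -- from the cycles already chosen.
      PartialFactor : List (Σ (Fin n) (λ _ → List (Fin n))) → Set
      PartialFactor Cs = All (λ (x , xs) → IsCycle D x xs) Cs × Unique (cycleVertices D Cs) ×
                         (∀ {y} → g y ∈ cycleVertices D Cs → y ∈ cycleVertices D Cs)

      extend : ∀ x Cs → PartialFactor Cs →
               ∃[ Cs′ ] (PartialFactor Cs′ × cycleVertices D Cs ⊆ cycleVertices D Cs′ ×
                         x ∈ cycleVertices D Cs′)
      extend x Cs pf@(cycles , unique , closed) with x ∈? cycleVertices D Cs
      ... | yes x∈Cs = Cs , pf , id , x∈Cs
      ... | no  x∉Cs = cycleAt x ∷ Cs ,
            (cycleAt-isCycle x ∷ cycles , ++⁺ (proj₁ (cycleAt-isCycle x)) unique disjoint , closed′) ,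
            ∈-++⁺ʳ (orbit x) , here refl
        where
        backwards : ∀ i → (g ^ i) x ∈ cycleVertices D Cs → x ∈ cycleVertices D Cs
        backwards zero    x∈Cs     = x∈Cs
        backwards (suc i) gⁱ⁺¹x∈Cs = backwards i (closed gⁱ⁺¹x∈Cs)

        disjoint : Disjoint (orbit x) (cycleVertices D Cs)
        disjoint (v∈orbit , v∈Cs) with ∈-orbit⁻ v∈orbit
        ... | i , refl = x∉Cs (backwards i v∈Cs)

        closed′ : ∀ {y} → g y ∈ orbit x ++ cycleVertices D Cs → y ∈ orbit x ++ cycleVertices D Cs
        closed′ gy∈ with ∈-++⁻ (orbit x) gy∈
        ... | inj₁ gy∈orbit = ∈-++⁺ˡ (preimage∈orbit gy∈orbit)
        ... | inj₂ gy∈Cs    = ∈-++⁺ʳ (orbit x) (closed gy∈Cs)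

      cover : ∀ xs → ∃[ Cs ] (PartialFactor Cs × All (_∈ cycleVertices D Cs) xs)
      cover []       = [] , ([] , [] , λ ()) , []
      cover (x ∷ xs) with cover xs
      ... | Cs , pf , covered with extend x Cs pf
      ...   | Cs′ , pf′ , Cs⊆Cs′ , x∈Cs′ = Cs′ , pf′ , x∈Cs′ ∷ All.map Cs⊆Cs′ covered

      injective-successor⇒cycleFactor : CycleFactor D
      injective-successor⇒cycleFactor with cover (allFin n)
      ... | Cs , (cycles , unique , _) , covered =
        Cs , cycles , unique , λ v → All.lookup covered (∈-allFin v)

open Hall using (Transversal; hall; outNeighbours; outNeighbours-hall; ∈-subset⁻)
open Cycles using (injective-successor⇒cycleFactor)

first-step : ∀ {A : Set ℓ} {R : Rel A ℓ′} {x y} → Star R x y → x ≢ y → ∃ (R x)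
first-step ε       x≢x = contradiction refl x≢x
first-step (r ◅ _) _   = _ , r

Strong⇒out-neighbour : (D : Digraph n) → 2 ≤ n → Strong D → ∀ u → ∃ (arc D u)
Strong⇒out-neighbour D (s≤s (s≤s _)) strong u =
  first-step (strong u (punchIn u zero)) (punchInᵢ≢i u zero ∘ sym)

outNeighbour-transversal⇒cycleFactor : (D : Digraph n) → Transversal (outNeighbours D) →
                                       CycleFactor D
outNeighbour-transversal⇒cycleFactor D (successor , successor∈N⁺ , successor-injective) =
  injective-successor⇒cycleFactor D (λ u → ∈-subset⁻ (successor∈N⁺ u)) successor-injective

theorem2p2 : (n : ℕ) (D : Digraph n) → 2 ≤ n → Strong D →
    SQuadrangular D → CycleFactor D
theorem2p2 n D 2≤n strong (q⁺-bound , _) =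
  outNeighbour-transversal⇒cycleFactor D
    (hall (outNeighbours D) (outNeighbours-hall D (Strong⇒out-neighbour D 2≤n strong) q⁺-bound))
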